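{- Let $G=(V,E)$ be an undirected graph with $m$ edges, let $x\in V$, and let $\nu,k>0$ satisfy $2\nu k+\nu+1\le 2m$. Construct the undirected capacitated graph $G'$ with vertex set $\{s\}\cup V\cup\{t\}$ ($s,t$ new vertices), where for each $u\in V$ there is an edge $(u,t)$ of capacity $\deg_G(u)$, each edge $(u,v)\in E$ has capacity $2\nu$, and there is an edge $(s,x)$ of capacity $2\nu k+\nu+1$. Let $F^*$ be the value of the maximum $s$-$t$ flow in $G'$. Then: (1) If $F^*=2\nu k+\nu+1$, there is no vertex partition $(S,T)$ of $G$ with $x\in S$, $\mathrm{vol}(S)\le\nu$ and $|E(S,V-S)|\le k$. (2) If $F^*\le 2\nu k+\nu$, there is a vertex partition $(S,T)$ of $G$ with $x\in S$ and $|E(S,V-S)|\le k$.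
   Context: A vertex partition $(S,T)$ means $S,T$ are non-empty, disjoint, and $S\cup T=V$. $\mathrm{vol}(S)=\sum_{u\in S}\deg_G(u)$, and $E(S,V-S)$ is the set of edges with one endpoint in $S$ and the other in $V-S$. -}

module Defs where

open import Data.Bool using (Bool; true; false; if_then_else_; not; _∧_)
open import Data.Nat as ℕ using (ℕ; _<ᵇ_)
open import Data.Fin using (Fin; toℕ; _≟_)
open import Relation.Nullary.Decidable using (⌊_⌋)
open import Data.List using (List; []; _∷_; map; foldr; allFin; _++_)
open import Data.Nat.ListAction using (sum)
open import Data.Integer using (+_)
open import Data.Rational as ℚ using (ℚ; 0ℚ; _/_)
open import Relation.Binary.PropositionalEquality using (_≡_)
open import Data.Product using (Σ; _×_)

record Graph (n : ℕ) : Set where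
  field
    adj    : Fin n → Fin n → Bool
    sym    : ∀ u v → adj u v ≡ adj v u
    irrefl : ∀ u → adj u u ≡ false
open Graph public

count : ∀ {n} → (Fin n → Bool) → ℕ
count {n} p = sum (map (λ i → if p i then 1 else 0) (allFin n))

deg : ∀ {n} → Graph n → Fin n → ℕ
deg G u = count (adj G u)

-- m = |E| : number of unordered adjacent pairs {u,v}, counted via u < v
edgeCount : ∀ {n} → Graph n → ℕ
edgeCount {n} G = sum (map (λ u → count (λ v → adj G u v ∧ (toℕ u <ᵇ toℕ v))) (allFin n))

vol : ∀ {n} → Graph n → (Fin n → Bool) → ℕ
vol {n} G S = sum (map (λ u → if S u then deg G u else 0) (allFin n))

cutSize : ∀ {n} → Graph n → (Fin n → Bool) → ℕ
cutSize {n} G S = sum (map (λ u → if S u then count (λ v → adj G u v ∧ not (S v)) else 0) (allFin n))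

IsVertexPartition : ∀ {n} → (Fin n → Bool) → Set
IsVertexPartition {n} S = Σ (Fin n) (λ u → S u ≡ true) × Σ (Fin n) (λ u → S u ≡ false)

data Node (n : ℕ) : Set where
  src : Node n
  vtx : Fin n → Node n
  snk : Node n

allNodes : ∀ n → List (Node n)
allNodes n = src ∷ map vtx (allFin n) ++ (snk ∷ [])

ℕ→ℚ : ℕ → ℚ
ℕ→ℚ a = (+ a) / 1

-- capacities of the undirected network G' (symmetric; 0 = no edge):
--   (s,x) : 2νk+ν+1,  (u,v) ∈ E : 2ν,  (u,t) : deg_G(u)
cap : ∀ {n} → Graph n → Fin n → (ν k : ℕ) → Node n → Node n → ℕ
cap G x ν k src (vtx u) = if ⌊ u ≟ x ⌋ then 2 ℕ.* ν ℕ.* k ℕ.+ ν ℕ.+ 1 else 0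
cap G x ν k (vtx u) src = if ⌊ u ≟ x ⌋ then 2 ℕ.* ν ℕ.* k ℕ.+ ν ℕ.+ 1 else 0
cap G x ν k (vtx u) (vtx w) = if adj G u w then 2 ℕ.* ν else 0
cap G x ν k (vtx u) snk = deg G u
cap G x ν k snk (vtx u) = deg G u
cap G x ν k _ _ = 0

sumNodes : ∀ {n} → (Node n → ℚ) → ℚ
sumNodes {n} g = foldr ℚ._+_ 0ℚ (map g (allNodes n))

-- An s-t flow in the undirected capacitated network G' (real-valued flows
-- taken rational; capacities are integers): skew-symmetric net flow f(a,b)
-- with |f(a,b)| ≤ cap(a,b) and conservation at every vertex other than s,t.
record IsFlow {n} (G : Graph n) (x : Fin n) (ν k : ℕ) (f : Node n → Node n → ℚ) : Set where
  field
    skew         : ∀ a b → f a b ≡ ℚ.- f b a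
    capacity     : ∀ a b → f a b ℚ.≤ ℕ→ℚ (cap G x ν k a b)
    conservation : ∀ u → sumNodes (f (vtx u)) ≡ 0ℚ

flowValue : ∀ {n} → (Node n → Node n → ℚ) → ℚ
flowValue f = sumNodes (f src)

IsMaxFlowValue : ∀ {n} → Graph n → Fin n → (ν k : ℕ) → ℚ → Set
IsMaxFlowValue G x ν k F =
  Σ (Node _ → Node _ → ℚ) (λ f → IsFlow G x ν k f × flowValue f ≡ F)
  × (∀ f → IsFlow G x ν k f → flowValue f ℚ.≤ F)

module Submission where

-- Everything rests on the cut {s} ∪ S of G', whose capacity is
-- (C if x ∉ S) + 2ν|E(S,V-S)| + vol(S) (cutCapacity-sourceSide).
-- Part (1) is weak duality: a flow is bounded by every s-t cut.
-- Part (2) runs Ford–Fulkerson with integral unit augmentations from the zero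
-- flow: the levels of nodes reachable by residual pairs stabilise (a
-- counting argument); if t is reachable one more unit is sent, otherwise the
-- stable level is a cut whose capacity equals the current value j ≤ 2νk + ν,
-- which forces x ∈ S, |E(S,V-S)| ≤ k and, by the handshake bound
-- vol(V) ≥ 2|E| ≥ C, some vertex outside S.  Reaching value C instead would
-- contradict maximality of F ≤ 2νk + ν.

module MaxFlowMinCut where

  open import Defs hiding (irrefl) renaming (sym to adj-sym)
  open import Data.Bool using (Bool; true; false; if_then_else_; not; _∧_; _∨_; T)
  import Data.Bool.Properties as BoolP
  open import Data.Bool.ListAction using (any)
  open import Data.Nat as ℕ using (ℕ; zero; suc)
  import Data.Nat.Properties as ℕP
  open import Data.Fin as Fin using (Fin; toℕ) renaming (zero to fz; suc to fs)
  import Data.Fin.Properties as FinP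
  open import Data.Integer as ℤ using (ℤ; -[1+_]; +[1+_])
  import Data.Integer.Properties as ℤP
  open import Data.Rational as ℚ using (ℚ; mkℚ; 0ℚ; 1ℚ; _/_; ↥_; _+_; _≤_; _<_; -_)
  import Data.Rational.Properties as ℚP
  import Data.Nat.Coprimality as Coprime
  open import Data.List using (List; []; _∷_; map; foldr; allFin; _++_; tabulate; length)
  import Data.List.Properties
  open import Data.List.Membership.Propositional using (_∈_; lose; find)
  import Data.List.Membership.Propositional.Properties as ∈P
  open import Data.List.Relation.Unary.Any using (here; there; satisfied)
  open import Data.List.Relation.Unary.Any.Properties using (any⁺; any⁻)
  open import Data.List.Relation.Unary.All as All using (all?)
  open import Data.List.Relation.Unary.All.Properties using (¬All⇒Any¬)
  open import Data.Nat.ListAction using (sum)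
  open import Relation.Binary.PropositionalEquality
  open import Relation.Nullary using (¬_; Dec; yes; no)
  open import Relation.Nullary.Decidable using (⌊_⌋; _→-dec_; toWitness; fromWitness)
  open import Data.Product using (Σ; _×_; _,_)
  open import Data.Sum using (_⊎_; inj₁; inj₂)
  open import Data.Empty using (⊥; ⊥-elim)
  open import Function using (_∘_; Equivalence)
  import Algebra.Properties.CommutativeSemigroup as CommSemigroupProps
  open import Algebra.Bundles using (CommutativeMonoid)

  ι : ℤ → ℚ
  ι z = mkℚ z 0 (Coprime.sym (Coprime.1-coprimeTo _))

  ι≡/ : ∀ z → ι z ≡ z / 1
  ι≡/ z = sym (ℚP.↥p/↧p≡p (ι z))

  ι-+ : ∀ a b → ι (a ℤ.+ b) ≡ ι a + ι b
  ι-+ a b = trans (ι≡/ _)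
    (cong (_/ 1) (cong₂ ℤ._+_ (sym (ℤP.*-identityʳ a)) (sym (ℤP.*-identityʳ b))))

  ι-≤ : ∀ {a b} → a ℤ.≤ b → ι a ≤ ι b
  ι-≤ {a} {b} p = ℚ.*≤* (subst₂ ℤ._≤_ (sym (ℤP.*-identityʳ a)) (sym (ℤP.*-identityʳ b)) p)

  ι-≤⁻ : ∀ {a b} → ι a ≤ ι b → a ℤ.≤ b
  ι-≤⁻ {a} {b} (ℚ.*≤* p) = subst₂ ℤ._≤_ (ℤP.*-identityʳ a) (ℤP.*-identityʳ b) p

  ι-<⁻ : ∀ {a b} → ι a < ι b → a ℤ.< b
  ι-<⁻ {a} {b} (ℚ.*<* p) = subst₂ ℤ._<_ (ℤP.*-identityʳ a) (ℤP.*-identityʳ b) p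

  ℕ→ℚ≡ι : ∀ a → ℕ→ℚ a ≡ ι (ℤ.+ a)
  ℕ→ℚ≡ι a = sym (ι≡/ (ℤ.+ a))

  ℕ→ℚ-+ : ∀ a b → ℕ→ℚ (a ℕ.+ b) ≡ ℕ→ℚ a + ℕ→ℚ b
  ℕ→ℚ-+ a b = trans (ℕ→ℚ≡ι _)
    (trans (ι-+ (ℤ.+ a) (ℤ.+ b)) (sym (cong₂ _+_ (ℕ→ℚ≡ι a) (ℕ→ℚ≡ι b))))

  ℕ→ℚ-≤ : ∀ {a b} → a ℕ.≤ b → ℕ→ℚ a ≤ ℕ→ℚ b
  ℕ→ℚ-≤ {a} {b} p = subst₂ _≤_ (sym (ℕ→ℚ≡ι a)) (sym (ℕ→ℚ≡ι b)) (ι-≤ (ℤ.+≤+ p))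

  ℕ→ℚ-≤⁻ : ∀ {a b} → ℕ→ℚ a ≤ ℕ→ℚ b → a ℕ.≤ b
  ℕ→ℚ-≤⁻ {a} {b} p = ℤP.drop‿+≤+ (ι-≤⁻ (subst₂ _≤_ (ℕ→ℚ≡ι a) (ℕ→ℚ≡ι b) p))

  integral-<⇒+1≤ : ∀ z c → ι z < ℕ→ℚ c → ι z + 1ℚ ≤ ℕ→ℚ c
  integral-<⇒+1≤ z c lt =
    subst₂ _≤_ (ι-+ z (ℤ.+ 1)) (sym (ℕ→ℚ≡ι c))
      (ι-≤ (subst (ℤ._≤ ℤ.+ c) (ℤP.+-comm (ℤ.+ 1) z)
        (ℤP.i<j⇒suc[i]≤j (ι-<⁻ (subst (ι z <_) (ℕ→ℚ≡ι c) lt)))))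

  self-negative⇒0 : ∀ q → q ≡ - q → q ≡ 0ℚ
  self-negative⇒0 q eq = ℚP.↥p≡0⇒p≡0 q (numerator (↥ q) (trans (cong ↥_ eq) (ℚP.↥-neg q)))
    where
    numerator : ∀ z → z ≡ ℤ.- z → z ≡ ℤ.+ 0
    numerator (ℤ.+ zero) _ = refl
    numerator +[1+ _ ] ()
    numerator -[1+ _ ] ()

  ∑ : {A : Set} → List A → (A → ℚ) → ℚ
  ∑ L g = foldr _+_ 0ℚ (map g L)

  module _ {A : Set} where

    ∑-cong : (L : List A) {g h : A → ℚ} → (∀ a → g a ≡ h a) → ∑ L g ≡ ∑ L h
    ∑-cong []      e = refl
    ∑-cong (a ∷ L) e = cong₂ _+_ (e a) (∑-cong L e)

    ∑-+ : (L : List A) (g h : A → ℚ) → ∑ L (λ a → g a + h a) ≡ ∑ L g + ∑ L h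
    ∑-+ []      g h = refl
    ∑-+ (a ∷ L) g h = trans (cong (g a + h a +_) (∑-+ L g h)) (interchange (g a) (h a) _ _)
      where open CommSemigroupProps (CommutativeMonoid.commutativeSemigroup ℚP.+-0-commutativeMonoid)

    ∑-0 : (L : List A) → ∑ L (λ _ → 0ℚ) ≡ 0ℚ
    ∑-0 []      = refl
    ∑-0 (a ∷ L) = trans (ℚP.+-identityˡ _) (∑-0 L)

    ∑-neg : (L : List A) (g : A → ℚ) → ∑ L (λ a → - g a) ≡ - ∑ L g
    ∑-neg []      g = refl
    ∑-neg (a ∷ L) g = trans (cong (- g a +_) (∑-neg L g)) (sym (ℚP.neg-distrib-+ (g a) _))

    ∑-mono : (L : List A) {g h : A → ℚ} → (∀ a → g a ≤ h a) → ∑ L g ≤ ∑ L h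
    ∑-mono []      e = ℚP.≤-refl
    ∑-mono (a ∷ L) e = ℚP.+-mono-≤ (e a) (∑-mono L e)

    ∑-++ : (L M : List A) (g : A → ℚ) → ∑ (L ++ M) g ≡ ∑ L g + ∑ M g
    ∑-++ []      M g = sym (ℚP.+-identityˡ _)
    ∑-++ (a ∷ L) M g = trans (cong (g a +_) (∑-++ L M g)) (sym (ℚP.+-assoc (g a) _ _))

    ∑-map : {B : Set} (L : List B) (f : B → A) (g : A → ℚ) → ∑ (map f L) g ≡ ∑ L (g ∘ f)
    ∑-map []      f g = refl
    ∑-map (b ∷ L) f g = cong (g (f b) +_) (∑-map L f g)

  ∑-swap : {A B : Set} (L : List A) (M : List B) (g : A → B → ℚ) →
    ∑ L (λ a → ∑ M (g a)) ≡ ∑ M (λ b → ∑ L (λ a → g a b))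
  ∑-swap []      M g = sym (∑-0 M)
  ∑-swap (a ∷ L) M g = trans (cong (∑ M (g a) +_) (∑-swap L M g))
    (sym (∑-+ M (g a) (λ b → ∑ L (λ a → g a b))))

  ℕ→ℚ-sum : {A : Set} (L : List A) (g : A → ℕ) → ℕ→ℚ (sum (map g L)) ≡ ∑ L (ℕ→ℚ ∘ g)
  ℕ→ℚ-sum []      g = refl
  ℕ→ℚ-sum (a ∷ L) g = trans (ℕ→ℚ-+ (g a) _) (cong (ℕ→ℚ (g a) +_) (ℕ→ℚ-sum L g))

  ∑Fin : (n : ℕ) → (Fin n → ℚ) → ℚ
  ∑Fin zero    h = 0ℚ
  ∑Fin (suc n) h = h fz + ∑Fin n (h ∘ fs)

  ∑-tabulate : {A : Set} (n : ℕ) (f : Fin n → A) (g : A → ℚ) → ∑ (tabulate f) g ≡ ∑Fin n (g ∘ f)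
  ∑-tabulate zero    f g = refl
  ∑-tabulate (suc n) f g = cong (g (f fz) +_) (∑-tabulate n (f ∘ fs) g)

  ∑-allFin : (n : ℕ) (g : Fin n → ℚ) → ∑ (allFin n) g ≡ ∑Fin n g
  ∑-allFin n g = ∑-tabulate n (λ i → i) g

  ∑Fin-cong : (n : ℕ) {g h : Fin n → ℚ} → (∀ a → g a ≡ h a) → ∑Fin n g ≡ ∑Fin n h
  ∑Fin-cong zero    e = refl
  ∑Fin-cong (suc n) e = cong₂ _+_ (e fz) (∑Fin-cong n (e ∘ fs))

  ∑Fin-0 : (n : ℕ) → ∑Fin n (λ _ → 0ℚ) ≡ 0ℚ
  ∑Fin-0 zero    = refl
  ∑Fin-0 (suc n) = trans (ℚP.+-identityˡ _) (∑Fin-0 n)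

  ∑Fin-point : (n : ℕ) (w : Fin n) (q : ℚ) → ∑Fin n (λ u → if ⌊ u Fin.≟ w ⌋ then q else 0ℚ) ≡ q
  ∑Fin-point (suc n) fz q =
    trans (cong (q +_) (∑Fin-0 n)) (ℚP.+-identityʳ q)
  ∑Fin-point (suc n) (fs w) q =
    trans (ℚP.+-identityˡ _)
      (trans (∑Fin-cong n (λ u → cong (λ b → if b then q else 0ℚ) (≟-suc u)))
        (∑Fin-point n w q))
    where
    ≟-suc : ∀ u → ⌊ fs u Fin.≟ fs w ⌋ ≡ ⌊ u Fin.≟ w ⌋
    ≟-suc u with u Fin.≟ w
    ... | yes _ = refl
    ... | no _  = refl

  -- Flow across a cut.

  -- For a skew-symmetric g, the pairs inside P cancel, so the total out of P
  -- equals the total from P to its complement.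
  ∑-out-of≡∑-across : {A : Set} (L : List A) (P : A → Bool) (g : A → A → ℚ) →
    (∀ a b → g a b ≡ - g b a) →
    ∑ L (λ a → if P a then ∑ L (g a) else 0ℚ) ≡
    ∑ L (λ a → if P a then ∑ L (λ b → if P b then 0ℚ else g a b) else 0ℚ)
  ∑-out-of≡∑-across L P g skew =
    trans (∑-cong L split)
      (trans (∑-+ L _ _)
        (trans (cong (_+ ∑ L across) inside≡0) (ℚP.+-identityˡ _)))
    where
    within : _ → _ → ℚ
    within a b = if P a then (if P b then g a b else 0ℚ) else 0ℚ

    across : _ → ℚ
    across a = if P a then ∑ L (λ b → if P b then 0ℚ else g a b) else 0ℚ

    within-skew : ∀ a b → within a b ≡ - within b a
    within-skew a b with P a | P b
    ... | true  | true  = skew a b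
    ... | true  | false = refl
    ... | false | true  = refl
    ... | false | false = refl

    inside≡0 : ∑ L (λ a → ∑ L (within a)) ≡ 0ℚ
    inside≡0 = self-negative⇒0 _
      (trans (∑-swap L L within)
        (trans (∑-cong L (λ b → trans (∑-cong L (λ a → within-skew a b)) (∑-neg L (within b))))
          (∑-neg L (λ b → ∑ L (within b)))))

    split : ∀ a → (if P a then ∑ L (g a) else 0ℚ) ≡ ∑ L (within a) + across a
    split a with P a
    ... | false = sym (trans (ℚP.+-identityʳ _) (∑-0 L))
    ... | true  = trans (∑-cong L pointwise) (∑-+ L _ _)
      where
      pointwise : ∀ b → g a b ≡ (if P b then g a b else 0ℚ) + (if P b then 0ℚ else g a b)
      pointwise b with P b
      ... | true  = sym (ℚP.+-identityʳ _)
      ... | false = sym (ℚP.+-identityˡ _)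

  ∨-elim : ∀ {a b} → a ∨ b ≡ true → a ≡ true ⊎ b ≡ true
  ∨-elim {true}  _ = inj₁ refl
  ∨-elim {false} e = inj₂ e

  ∨-false : ∀ {a b} → a ∨ b ≡ false → a ≡ false × b ≡ false
  ∨-false {false} {false} _ = refl , refl

  ∨-introʳ : ∀ a {b} → b ≡ true → a ∨ b ≡ true
  ∨-introʳ a refl = BoolP.∨-zeroʳ a

  ∧-elim : ∀ {a b} → a ∧ b ≡ true → a ≡ true × b ≡ true
  ∧-elim {true} {true} _ = refl , refl

  true≢false : true ≡ false → ⊥
  true≢false ()

  ¬⇒-elim : ∀ {b c} → ¬ (b ≡ true → c ≡ true) → b ≡ true × c ≡ false
  ¬⇒-elim {true}  {false} _ = refl , refl
  ¬⇒-elim {true}  {true}  h = ⊥-elim (h (λ _ → refl))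
  ¬⇒-elim {false}         h = ⊥-elim (h (λ ()))

  ⌊⌋-sound : ∀ {P : Set} (d : Dec P) → ⌊ d ⌋ ≡ true → P
  ⌊⌋-sound d e = toWitness (Equivalence.from BoolP.T-≡ e)

  module _ {A : Set} (p : A → Bool) where

    any-witness : ∀ L → any p L ≡ true → Σ A (λ a → p a ≡ true)
    any-witness L e with satisfied (any⁻ p L (Equivalence.from BoolP.T-≡ e))
    ... | a , pa = a , Equivalence.to BoolP.T-≡ pa

    any-intro : ∀ {L a} → a ∈ L → p a ≡ true → any p L ≡ true
    any-intro a∈L pa = Equivalence.to BoolP.T-≡
      (any⁺ p (lose {P = λ b → T (p b)} a∈L (Equivalence.from BoolP.T-≡ pa)))

    countTrue : List A → ℕ
    countTrue []      = 0
    countTrue (a ∷ L) = (if p a then 1 else 0) ℕ.+ countTrue L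

    countTrue≤length : ∀ L → countTrue L ℕ.≤ length L
    countTrue≤length []      = ℕ.z≤n
    countTrue≤length (a ∷ L) with p a
    ... | true  = ℕ.s≤s (countTrue≤length L)
    ... | false = ℕP.m≤n⇒m≤1+n (countTrue≤length L)

  module _ {A : Set} (p q : A → Bool) (p⊆q : ∀ a → p a ≡ true → q a ≡ true) where

    private
      indicator-mono : ∀ a → (if p a then 1 else 0) ℕ.≤ (if q a then 1 else 0)
      indicator-mono a with p a in pa
      ... | false = ℕ.z≤n
      ... | true rewrite p⊆q a pa = ℕP.≤-refl

    countTrue-mono : ∀ L → countTrue p L ℕ.≤ countTrue q L
    countTrue-mono []      = ℕ.z≤n
    countTrue-mono (a ∷ L) = ℕP.+-mono-≤ (indicator-mono a) (countTrue-mono L)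

    countTrue-strict : ∀ {L w} → w ∈ L → p w ≡ false → q w ≡ true → countTrue p L ℕ.< countTrue q L
    countTrue-strict {a ∷ L} (here refl) pw qw rewrite pw | qw = ℕ.s≤s (countTrue-mono L)
    countTrue-strict {a ∷ L} (there w∈L) pw qw =
      ℕP.+-mono-≤-< (indicator-mono a) (countTrue-strict w∈L pw qw)

  -- An increasing chain P 0 ⊆ P 1 ⊆ … of Boolean subsets of a finite type
  -- (enumerated by L) is eventually stable: each strict step adds an element,
  -- which can happen at most length L times.
  module IncreasingChain {A : Set} (L : List A) (complete : ∀ a → a ∈ L)
                         (P : ℕ → A → Bool)
                         (increasing : ∀ i a → P i a ≡ true → P (suc i) a ≡ true) where

    Stable : ℕ → Set
    Stable i = ∀ a → P (suc i) a ≡ true → P i a ≡ true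

    private
      stable? : ∀ i a → Dec (P (suc i) a ≡ true → P i a ≡ true)
      stable? i a = (P (suc i) a BoolP.≟ true) →-dec (P i a BoolP.≟ true)

      stableOrLarge : ∀ i → Σ ℕ Stable ⊎ i ℕ.≤ countTrue (P i) L
      stableOrLarge zero = inj₂ ℕ.z≤n
      stableOrLarge (suc i) with stableOrLarge i
      ... | inj₁ stable = inj₁ stable
      ... | inj₂ large with all? (stable? i) L
      ... | yes all-stable = inj₁ (i , λ a → All.lookup all-stable (complete a))
      ... | no ¬all-stable with find (¬All⇒Any¬ (stable? i) L ¬all-stable)
      ... | a , a∈L , new with ¬⇒-elim new
      ... | inNext , notInThis =
        inj₂ (ℕP.≤-<-trans large (countTrue-strict (P i) (P (suc i)) (increasing i) a∈L notInThis inNext))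

    stabilises : Σ ℕ Stable
    stabilises with stableOrLarge (suc (length L))
    ... | inj₁ stable = stable
    ... | inj₂ large  = ⊥-elim (ℕP.<⇒≱ large (countTrue≤length (P (suc (length L))) L))

  module _ {n : ℕ} where

    _==_ : Node n → Node n → Bool
    src   == src   = true
    vtx u == vtx w = ⌊ u Fin.≟ w ⌋
    snk   == snk   = true
    _     == _     = false

    ==-sound : ∀ {a b : Node n} → a == b ≡ true → a ≡ b
    ==-sound {src}   {src}   _ = refl
    ==-sound {vtx u} {vtx w} e = cong vtx (⌊⌋-sound (u Fin.≟ w) e)
    ==-sound {snk}   {snk}   _ = refl

    separated : ∀ (R : Node n → Bool) {a b} → R a ≡ true → R b ≡ false → a == b ≡ false
    separated R {a} {b} a∈ b∉ with a == b in eq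
    ... | false = refl
    ... | true  = ⊥-elim (true≢false (trans (sym a∈) (trans (cong R (==-sound eq)) b∉)))

    ∈-allNodes : ∀ (a : Node n) → a ∈ allNodes n
    ∈-allNodes src     = here refl
    ∈-allNodes (vtx u) = there (∈P.∈-++⁺ˡ (∈P.∈-map⁺ vtx (∈P.∈-allFin u)))
    ∈-allNodes snk     = there (∈P.∈-++⁺ʳ (map vtx (allFin n)) (here refl))

    ∑Nodes-split : (h : Node n → ℚ) →
      sumNodes h ≡ h src + (∑Fin n (h ∘ vtx) + (h snk + 0ℚ))
    ∑Nodes-split h = cong (h src +_) (trans (∑-++ (map vtx (allFin n)) (snk ∷ []) h)
      (cong (_+ (h snk + 0ℚ)) (trans (∑-map (allFin n) vtx h) (∑-allFin n (h ∘ vtx)))))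

    ∑Nodes-point : (a : Node n) (q : ℚ) → sumNodes (λ b → if b == a then q else 0ℚ) ≡ q
    ∑Nodes-point src q =
      trans (∑Nodes-split (λ b → if b == src then q else 0ℚ)) (trans (cong (λ z → q + (z + (0ℚ + 0ℚ))) (∑Fin-0 n)) (ℚP.+-identityʳ q))
    ∑Nodes-point (vtx w) q =
      trans (∑Nodes-split (λ b → if b == vtx w then q else 0ℚ))
        (trans (ℚP.+-identityˡ _) (trans (cong (_+ (0ℚ + 0ℚ)) (∑Fin-point n w q)) (ℚP.+-identityʳ q)))
    ∑Nodes-point snk q =
      trans (∑Nodes-split (λ b → if b == snk then q else 0ℚ))
        (trans (ℚP.+-identityˡ _)
          (trans (cong (_+ (q + 0ℚ)) (∑Fin-0 n)) (trans (ℚP.+-identityˡ _) (ℚP.+-identityʳ q))))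

  sum-map-cong : {A : Set} (L : List A) {f g : A → ℕ} → (∀ a → f a ≡ g a) →
    sum (map f L) ≡ sum (map g L)
  sum-map-cong L e = cong sum (Data.List.Properties.map-cong e L)

  sum-map-+ : {A : Set} (L : List A) (f g : A → ℕ) →
    sum (map (λ a → f a ℕ.+ g a) L) ≡ sum (map f L) ℕ.+ sum (map g L)
  sum-map-+ []      f g = refl
  sum-map-+ (a ∷ L) f g =
    trans (cong (f a ℕ.+ g a ℕ.+_) (sum-map-+ L f g)) (interchange (f a) (g a) _ _)
    where open CommSemigroupProps ℕP.+-commutativeSemigroup

  sum-map-* : {A : Set} (L : List A) (c : ℕ) (f : A → ℕ) →
    c ℕ.* sum (map f L) ≡ sum (map (λ a → c ℕ.* f a) L)
  sum-map-* []      c f = ℕP.*-zeroʳ c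
  sum-map-* (a ∷ L) c f =
    trans (ℕP.*-distribˡ-+ c (f a) _) (cong (c ℕ.* f a ℕ.+_) (sum-map-* L c f))

  -- Handshake inequality: every edge {u,v} with u < v is counted in both
  -- deg(u) and deg(v), so 2|E| ≤ vol(V).
  2edges≤vol : ∀ {n} (G : Graph n) → 2 ℕ.* edgeCount G ℕ.≤ vol G (λ _ → true)
  2edges≤vol {n} G = ℕ→ℚ-≤⁻ (subst₂ _≤_ (sym twiceEdges) (sym volume) oriented≤adjacent)
    where
    L = allFin n
    before : Fin n → Fin n → ℕ
    before u v = if adj G u v ∧ (toℕ u ℕ.<ᵇ toℕ v) then 1 else 0
    edges adjacent : ℚ
    edges = ∑ L (λ u → ∑ L (ℕ→ℚ ∘ before u))
    adjacent = ∑ L (λ u → ∑ L (λ v → ℕ→ℚ (if adj G u v then 1 else 0)))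
    twiceEdges : ℕ→ℚ (2 ℕ.* edgeCount G) ≡ edges + edges
    twiceEdges =
      trans (ℕ→ℚ-+ (edgeCount G) (edgeCount G ℕ.+ 0))
        (cong₂ _+_ edgeSum (trans (cong ℕ→ℚ (ℕP.+-identityʳ (edgeCount G))) edgeSum))
      where
      edgeSum : ℕ→ℚ (edgeCount G) ≡ edges
      edgeSum = trans (ℕ→ℚ-sum L (λ u → count (λ v → adj G u v ∧ (toℕ u ℕ.<ᵇ toℕ v))))
                  (∑-cong L (λ u → ℕ→ℚ-sum L (before u)))
    volume : ℕ→ℚ (vol G (λ _ → true)) ≡ adjacent
    volume = trans (ℕ→ℚ-sum L (deg G)) (∑-cong L (λ u → ℕ→ℚ-sum L (λ v → if adj G u v then 1 else 0)))
    oneOrientation : ∀ u v → before u v ℕ.+ before v u ℕ.≤ (if adj G u v then 1 else 0)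
    oneOrientation u v rewrite adj-sym G v u
      with adj G u v | toℕ u ℕ.<ᵇ toℕ v in u<v | toℕ v ℕ.<ᵇ toℕ u in v<u
    ... | false | _     | _     = ℕ.z≤n
    ... | true  | true  | false = ℕP.≤-refl
    ... | true  | false | true  = ℕP.≤-refl
    ... | true  | false | false = ℕ.z≤n
    ... | true  | true  | true  =
      ⊥-elim (ℕP.<-asym (ℕP.<ᵇ⇒< (toℕ u) (toℕ v) (subst T (sym u<v) _))
                        (ℕP.<ᵇ⇒< (toℕ v) (toℕ u) (subst T (sym v<u) _)))
    oriented≤adjacent : edges + edges ≤ adjacent
    oriented≤adjacent =
      subst (_≤ adjacent)
        (trans (∑-cong L (λ u → ∑-+ L (ℕ→ℚ ∘ before u) (λ v → ℕ→ℚ (before v u))))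
          (trans (∑-+ L (λ u → ∑ L (ℕ→ℚ ∘ before u)) (λ u → ∑ L (λ v → ℕ→ℚ (before v u))))
            (cong (edges +_) (sym (∑-swap L L (λ v u → ℕ→ℚ (before v u)))))))
        (∑-mono L (λ u → ∑-mono L (λ v →
          subst (_≤ ℕ→ℚ (if adj G u v then 1 else 0)) (ℕ→ℚ-+ (before u v) (before v u)) (ℕ→ℚ-≤ (oneOrientation u v)))))

  -- With ν > 0, 2ν·e ≤ 2νk + ν forces e ≤ k (else 2ν(k+1) ≤ 2νk + ν).
  2νe≤2νk+ν⇒e≤k : ∀ {ν} k e → 0 ℕ.< ν → 2 ℕ.* ν ℕ.* e ℕ.≤ 2 ℕ.* ν ℕ.* k ℕ.+ ν → e ℕ.≤ k
  2νe≤2νk+ν⇒e≤k {ν} k e ν>0 bound with e ℕP.≤? k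
  ... | yes e≤k = e≤k
  ... | no  e≰k = ⊥-elim (ℕP.<⇒≱ ν<2ν (ℕP.+-cancelˡ-≤ (2 ℕ.* ν ℕ.* k) (2 ℕ.* ν) ν 2νk+2ν≤2νk+ν))
    where
    ν<2ν : ν ℕ.< 2 ℕ.* ν
    ν<2ν = subst (ν ℕ.<_) (cong (ν ℕ.+_) (sym (ℕP.+-identityʳ ν))) (ℕP.m<m+n ν ν>0)
    2νk+2ν≤2νk+ν : 2 ℕ.* ν ℕ.* k ℕ.+ 2 ℕ.* ν ℕ.≤ 2 ℕ.* ν ℕ.* k ℕ.+ ν
    2νk+2ν≤2νk+ν = ℕP.≤-trans (ℕP.≤-reflexive (trans (ℕP.+-comm _ (2 ℕ.* ν)) (sym (ℕP.*-suc (2 ℕ.* ν) k))))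
                     (ℕP.≤-trans (ℕP.*-monoʳ-≤ (2 ℕ.* ν) (ℕP.≰⇒> e≰k)) bound)

  module Network {n : ℕ} (G : Graph n) (x : Fin n) (ν k : ℕ) where

    C Y : ℕ
    C = 2 ℕ.* ν ℕ.* k ℕ.+ ν ℕ.+ 1
    Y = 2 ℕ.* ν ℕ.* k ℕ.+ ν

    c : Node n → Node n → ℚ
    c a b = ℕ→ℚ (cap G x ν k a b)

    Flow : Set
    Flow = Node n → Node n → ℚ

    cutCapacity : (Node n → Bool) → ℚ
    cutCapacity R = sumNodes (λ a → if R a then sumNodes (λ b → if R b then 0ℚ else c a b) else 0ℚ)

    cutCapacity-cong : ∀ {R R′} → (∀ a → R a ≡ R′ a) → cutCapacity R ≡ cutCapacity R′
    cutCapacity-cong {R} {R′} e = ∑-cong (allNodes n) row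
      where
      row : ∀ a → (if R a then sumNodes (λ b → if R b then 0ℚ else c a b) else 0ℚ)
                ≡ (if R′ a then sumNodes (λ b → if R′ b then 0ℚ else c a b) else 0ℚ)
      row a rewrite e a = cong (λ z → if R′ a then z else 0ℚ)
        (∑-cong (allNodes n) (λ b → cong (λ r → if r then 0ℚ else c a b) (e b)))

    sourceSide : (Fin n → Bool) → Node n → Bool
    sourceSide S src     = true
    sourceSide S (vtx u) = S u
    sourceSide S snk     = false

    -- Its capacity, in ℕ: the edge (s,x) if x ∉ S, 2ν per cut edge of G, and
    -- deg(u) for the edge (u,t) of every u ∈ S.
    sideCapacity : (Fin n → Bool) → ℕ
    sideCapacity S = (if S x then 0 else C) ℕ.+ (2 ℕ.* ν ℕ.* cutSize G S ℕ.+ vol G S)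

    outOfSide : (Fin n → Bool) → Fin n → ℕ
    outOfSide S u = sum (map (λ w → if S w then 0 else (if adj G u w then 2 ℕ.* ν else 0)) (allFin n)) ℕ.+ deg G u

    cut+vol≡∑outOfSide : ∀ S →
      2 ℕ.* ν ℕ.* cutSize G S ℕ.+ vol G S ≡ sum (map (λ u → if S u then outOfSide S u else 0) (allFin n))
    cut+vol≡∑outOfSide S =
      trans (cong (ℕ._+ vol G S) (sum-map-* (allFin n) (2 ℕ.* ν) _))
        (trans (sym (sum-map-+ (allFin n) _ _)) (sum-map-cong (allFin n) row))
      where
      entry : ∀ u w → 2 ℕ.* ν ℕ.* (if adj G u w ∧ not (S w) then 1 else 0)
                      ≡ (if S w then 0 else (if adj G u w then 2 ℕ.* ν else 0))
      entry u w with adj G u w | S w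
      ... | true  | true  = ℕP.*-zeroʳ (2 ℕ.* ν)
      ... | true  | false = ℕP.*-identityʳ (2 ℕ.* ν)
      ... | false | true  = ℕP.*-zeroʳ (2 ℕ.* ν)
      ... | false | false = ℕP.*-zeroʳ (2 ℕ.* ν)
      row : ∀ u → 2 ℕ.* ν ℕ.* (if S u then count (λ w → adj G u w ∧ not (S w)) else 0) ℕ.+ (if S u then deg G u else 0)
                  ≡ (if S u then outOfSide S u else 0)
      row u with S u
      ... | true  = cong (ℕ._+ deg G u) (trans (sum-map-* (allFin n) (2 ℕ.* ν) _) (sum-map-cong (allFin n) (entry u)))
      ... | false = cong (ℕ._+ 0) (ℕP.*-zeroʳ (2 ℕ.* ν))

    ℕ→ℚ-sumFin : (g : Fin n → ℕ) → ℕ→ℚ (sum (map g (allFin n))) ≡ ∑Fin n (ℕ→ℚ ∘ g)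
    ℕ→ℚ-sumFin g = trans (ℕ→ℚ-sum (allFin n) g) (∑-allFin n (ℕ→ℚ ∘ g))

    -- The row of s in the cut: only (s,x) can leave, and it does iff x ∉ S.
    sourceRow : ∀ S → sumNodes (λ b → if sourceSide S b then 0ℚ else c src b) ≡ ℕ→ℚ (if S x then 0 else C)
    sourceRow S =
      trans (∑Nodes-split (λ b → if sourceSide S b then 0ℚ else c src b))
        (trans (ℚP.+-identityˡ _)
          (trans (ℚP.+-identityʳ _)
            (trans (∑Fin-cong n entry) (∑Fin-point n x _))))
      where
      entry : ∀ u → (if S u then 0ℚ else c src (vtx u)) ≡ (if ⌊ u Fin.≟ x ⌋ then ℕ→ℚ (if S x then 0 else C) else 0ℚ)
      entry u with u Fin.≟ x
      ... | yes refl with S u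
      ...   | true  = refl
      ...   | false = refl
      entry u | no _ with S u
      ...   | true  = refl
      ...   | false = refl

    vertexRow : ∀ S u → sumNodes (λ b → if sourceSide S b then 0ℚ else c (vtx u) b) ≡ ℕ→ℚ (outOfSide S u)
    vertexRow S u =
      trans (∑Nodes-split (λ b → if sourceSide S b then 0ℚ else c (vtx u) b))
        (trans (ℚP.+-identityˡ _)
          (trans (cong (∑Fin n (λ w → if S w then 0ℚ else c (vtx u) (vtx w)) +_) (ℚP.+-identityʳ _))
            (sym (trans (ℕ→ℚ-+ (sum (map toOutside (allFin n))) (deg G u))
              (cong (_+ ℕ→ℚ (deg G u)) (trans (ℕ→ℚ-sumFin toOutside) (∑Fin-cong n entry)))))))
      where
      toOutside : Fin n → ℕ
      toOutside w = if S w then 0 else (if adj G u w then 2 ℕ.* ν else 0)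

      entry : ∀ w → ℕ→ℚ (if S w then 0 else (if adj G u w then 2 ℕ.* ν else 0)) ≡ (if S w then 0ℚ else c (vtx u) (vtx w))
      entry w with S w
      ... | true  = refl
      ... | false = refl

    cutCapacity-sourceSide : ∀ S → cutCapacity (sourceSide S) ≡ ℕ→ℚ (sideCapacity S)
    cutCapacity-sourceSide S = begin
      cutCapacity (sourceSide S)
        ≡⟨ ∑Nodes-split (λ a → if sourceSide S a then out a else 0ℚ) ⟩
      out src + (∑Fin n (λ u → if S u then out (vtx u) else 0ℚ) + (0ℚ + 0ℚ))
        ≡⟨ cong₂ _+_ (sourceRow S) (trans (ℚP.+-identityʳ _) (∑Fin-cong n row)) ⟩
      ℕ→ℚ (if S x then 0 else C) + ∑Fin n (λ u → ℕ→ℚ (if S u then outOfSide S u else 0))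
        ≡⟨ cong (ℕ→ℚ (if S x then 0 else C) +_) (sym (ℕ→ℚ-sumFin (λ u → if S u then outOfSide S u else 0))) ⟩
      ℕ→ℚ (if S x then 0 else C) + ℕ→ℚ (sum (map (λ u → if S u then outOfSide S u else 0) (allFin n)))
        ≡⟨ cong (λ z → ℕ→ℚ (if S x then 0 else C) + ℕ→ℚ z) (sym (cut+vol≡∑outOfSide S)) ⟩
      ℕ→ℚ (if S x then 0 else C) + ℕ→ℚ (2 ℕ.* ν ℕ.* cutSize G S ℕ.+ vol G S)
        ≡⟨ sym (ℕ→ℚ-+ (if S x then 0 else C) (2 ℕ.* ν ℕ.* cutSize G S ℕ.+ vol G S)) ⟩
      ℕ→ℚ (sideCapacity S) ∎
      where
      open ≡-Reasoning
      out : Node n → ℚ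
      out a = sumNodes (λ b → if sourceSide S b then 0ℚ else c a b)
      row : ∀ u → (if S u then out (vtx u) else 0ℚ) ≡ ℕ→ℚ (if S u then outOfSide S u else 0)
      row u with S u
      ... | true  = vertexRow S u
      ... | false = refl

    outflow≡value : (f : Flow) → (∀ u → sumNodes (f (vtx u)) ≡ 0ℚ) →
      (R : Node n → Bool) → R src ≡ true → R snk ≡ false →
      sumNodes (λ a → if R a then sumNodes (f a) else 0ℚ) ≡ flowValue f
    outflow≡value f conserve R s∈R t∉R =
      trans (∑Nodes-split out)
        (trans (cong₂ _+_ source (cong₂ _+_ (trans (∑Fin-cong n vertex) (∑Fin-0 n)) (cong (_+ 0ℚ) sink)))
          (trans (cong (flowValue f +_) (trans (ℚP.+-identityˡ _) (ℚP.+-identityˡ _))) (ℚP.+-identityʳ _)))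
      where
      out : Node n → ℚ
      out a = if R a then sumNodes (f a) else 0ℚ
      source : out src ≡ flowValue f
      source rewrite s∈R = refl
      sink : out snk ≡ 0ℚ
      sink rewrite t∉R = refl
      vertex : ∀ u → out (vtx u) ≡ 0ℚ
      vertex u with R (vtx u)
      ... | true  = conserve u
      ... | false = refl

    value≤cutCapacity : (f : Flow) → IsFlow G x ν k f →
      (R : Node n → Bool) → R src ≡ true → R snk ≡ false → flowValue f ≤ cutCapacity R
    value≤cutCapacity f isFlow R s∈R t∉R =
      subst (_≤ cutCapacity R) (outflow≡value f (IsFlow.conservation isFlow) R s∈R t∉R)
        (subst (_≤ cutCapacity R) (sym (∑-out-of≡∑-across (allNodes n) R f (IsFlow.skew isFlow)))
          (∑-mono (allNodes n) row))
      where
      row : ∀ a → (if R a then sumNodes (λ b → if R b then 0ℚ else f a b) else 0ℚ)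
                ≤ (if R a then sumNodes (λ b → if R b then 0ℚ else c a b) else 0ℚ)
      row a with R a
      ... | false = ℚP.≤-refl
      ... | true  = ∑-mono (allNodes n) entry
        where
        entry : ∀ b → (if R b then 0ℚ else f a b) ≤ (if R b then 0ℚ else c a b)
        entry b with R b
        ... | true  = ℚP.≤-refl
        ... | false = IsFlow.capacity isFlow a b

    -- Part (1): a set S ∋ x with vol(S) ≤ ν and |E(S,V-S)| ≤ k gives an s-t cut
    -- of capacity at most 2νk + ν, so no flow can reach C = 2νk + ν + 1.
    saturated⇒noSmallSet : (F : ℚ) → IsMaxFlowValue G x ν k F → F ≡ ℕ→ℚ C →
      ¬ Σ (Fin n → Bool) (λ S → IsVertexPartition S × S x ≡ true × vol G S ℕ.≤ ν × cutSize G S ℕ.≤ k)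
    saturated⇒noSmallSet F ((f , isFlow , value) , _) F≡C (S , _ , x∈S , volS≤ν , cutS≤k) =
      ℕP.m+1+n≰m Y (ℕP.≤-trans C≤side side≤Y)
      where
      C≤side : C ℕ.≤ sideCapacity S
      C≤side = ℕ→ℚ-≤⁻ (subst₂ _≤_ (trans value F≡C) (cutCapacity-sourceSide S)
                         (value≤cutCapacity f isFlow (sourceSide S) refl refl))
      side≤Y : sideCapacity S ℕ.≤ Y
      side≤Y rewrite x∈S = ℕP.+-mono-≤ (ℕP.*-monoʳ-≤ (2 ℕ.* ν) cutS≤k) volS≤ν

    -- Augmenting along residual paths, one unit at a time.

    record IntegralPseudoflow (f : Flow) : Set where
      field
        skew     : ∀ a b → f a b ≡ - f b a
        capacity : ∀ a b → f a b ≤ c a b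
        integral : ∀ a b → Σ ℤ (λ z → f a b ≡ ι z)
    open IntegralPseudoflow

    netOut : Flow → Node n → ℚ
    netOut f a = sumNodes (f a)

    -- (a,b) has residual capacity in f.  Kept abstract so that the rational
    -- comparison is never unfolded during type checking; it is used only
    -- through the three lemmas below.
    abstract
      residual : Flow → Node n → Node n → Bool
      residual f a b = ⌊ f a b ℚP.<? c a b ⌋

      residual-sound : ∀ f a b → residual f a b ≡ true → f a b < c a b
      residual-sound f a b = ⌊⌋-sound (f a b ℚP.<? c a b)

      residual-complete : ∀ f a b → f a b < c a b → residual f a b ≡ true
      residual-complete f a b lt = Equivalence.to BoolP.T-≡ (fromWitness lt)

      residual-cong : ∀ f g a b → f a b ≡ g a b → residual f a b ≡ residual g a b
      residual-cong f g a b e = cong (λ q → ⌊ q ℚP.<? c a b ⌋) e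

    reach : ℕ → Flow → Node n → Bool
    reach zero    f v = v == src
    reach (suc i) f v = reach i f v ∨ any (λ a → reach i f a ∧ residual f a v) (allNodes n)

    reach-src : ∀ i f → reach i f src ≡ true
    reach-src zero    f = refl
    reach-src (suc i) f rewrite reach-src i f = refl

    reach-mono : ∀ f i v → reach i f v ≡ true → reach (suc i) f v ≡ true
    reach-mono f i v e rewrite e = refl

    module Levels (f : Flow) = IncreasingChain (allNodes n) ∈-allNodes (λ i → reach i f) (reach-mono f)

    reach-preserved : ∀ j f f′ v → (∀ p q → p == v ≡ false → q == v ≡ false → f′ p q ≡ f p q) →
      reach j f v ≡ false → ∀ w → reach j f w ≡ true → reach j f′ w ≡ true
    reach-preserved zero    f f′ v same v∉ w w∈ = w∈
    reach-preserved (suc j) f f′ v same v∉ w w∈ with ∨-false {reach j f v} v∉ | ∨-elim {reach j f w} w∈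
    ... | v∉j , _ | inj₁ w∈j rewrite reach-preserved j f f′ v same v∉j w w∈j = refl
    ... | v∉j , _ | inj₂ step with any-witness (λ a → reach j f a ∧ residual f a w) (allNodes n) step
    ...   | a , e with ∧-elim {reach j f a} e
    ...     | a∈j , res = ∨-introʳ (reach j f′ w) (any-intro _ (∈-allNodes a) a∈j′∧res′)
      where
      a∈j′∧res′ : (reach j f′ a ∧ residual f′ a w) ≡ true
      a∈j′∧res′ rewrite reach-preserved j f f′ v same v∉j a a∈j =
        trans (residual-cong f′ f a w (same a w (separated (reach j f) a∈j v∉j)
                                                 (separated (reach (suc j) f) w∈ v∉))) res

    bit : Bool → ℚ
    bit b = if b then 1ℚ else 0ℚ

    unit : Node n → Node n → Flow
    unit a v p q = bit (p == a ∧ q == v) + - bit (p == v ∧ q == a)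

    push : Flow → Node n → Node n → Flow
    push f a v p q = f p q + unit a v p q

    unit-skew : ∀ a v p q → unit a v p q ≡ - unit a v q p
    unit-skew a v p q rewrite BoolP.∧-comm (q == a) (p == v) | BoolP.∧-comm (q == v) (p == a) =
      antisym (p == a ∧ q == v) (p == v ∧ q == a)
      where
      antisym : ∀ X Z → bit X + - bit Z ≡ - (bit Z + - bit X)
      antisym true  true  = refl
      antisym true  false = refl
      antisym false true  = refl
      antisym false false = refl

    unit-integral : ∀ a v p q → Σ ℤ (λ z → unit a v p q ≡ ι z)
    unit-integral a v p q = integer (p == a ∧ q == v) (p == v ∧ q == a)
      where
      integer : ∀ X Z → Σ ℤ (λ z → bit X + - bit Z ≡ ι z)
      integer true  true  = ℤ.+ 0 , refl
      integer true  false = ℤ.+ 1 , refl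
      integer false true  = -[1+ 0 ] , refl
      integer false false = ℤ.+ 0 , refl

    push-pseudoflow : ∀ f a v → IntegralPseudoflow f → f a v < c a v → IntegralPseudoflow (push f a v)
    skew (push-pseudoflow f a v P _) p q =
      trans (cong₂ _+_ (skew P p q) (unit-skew a v p q)) (sym (ℚP.neg-distrib-+ (f q p) (unit a v q p)))
    integral (push-pseudoflow f a v P _) p q with integral P p q | unit-integral a v p q
    ... | z , fz≡ | y , unit≡ = z ℤ.+ y , trans (cong₂ _+_ fz≡ unit≡) (sym (ι-+ z y))
    capacity (push-pseudoflow f a v P residualAV) p q with p == a ∧ q == v in forward | p == v ∧ q == a in backward
    ... | true  | true  = subst (_≤ c p q) (sym (ℚP.+-identityʳ (f p q))) (capacity P p q)
    ... | false | false = subst (_≤ c p q) (sym (ℚP.+-identityʳ (f p q))) (capacity P p q)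
    ... | false | true  =
      ℚP.≤-trans (subst (f p q + - 1ℚ ≤_) (ℚP.+-identityʳ (f p q)) (ℚP.+-monoʳ-≤ (f p q) (ℚ.*≤* ℤ.-≤+)))
        (capacity P p q)
    ... | true  | false with ∧-elim {p == a} forward
    ...   | p≡a , q≡v with ==-sound {a = p} p≡a | ==-sound {a = q} q≡v
    ...     | refl | refl with integral P a v
    ...       | z , fav≡z = subst (λ r → r + 1ℚ ≤ c a v) (sym fav≡z)
                                (integral-<⇒+1≤ z (cap G x ν k a v) (subst (_< c a v) fav≡z residualAV))

    ∑-bit : ∀ b (v : Node n) → sumNodes (λ q → bit (b ∧ q == v)) ≡ bit b
    ∑-bit true  v = ∑Nodes-point v 1ℚ
    ∑-bit false v = ∑-0 (allNodes n)

    netOut-push : ∀ f a v w → netOut (push f a v) w ≡ netOut f w + (bit (w == a) + - bit (w == v))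
    netOut-push f a v w =
      trans (∑-+ (allNodes n) (f w) (unit a v w))
        (cong (netOut f w +_)
          (trans (∑-+ (allNodes n) (λ q → bit (w == a ∧ q == v)) (λ q → - bit (w == v ∧ q == a)))
            (cong₂ _+_ (∑-bit (w == a) v)
              (trans (∑-neg (allNodes n) (λ q → bit (w == v ∧ q == a))) (cong -_ (∑-bit (w == v) a))))))

    push-avoiding : ∀ f a v p q → p == v ≡ false → q == v ≡ false → push f a v p q ≡ f p q
    push-avoiding f a v p q p≢v q≢v rewrite p≢v | q≢v | BoolP.∧-zeroʳ (p == a) = ℚP.+-identityʳ (f p q)

    -- Moving a unit from v to a and then from a to s moves it from v to s.
    telescope : ∀ F A V S → (F + (A + - V)) + (S + - A) ≡ F + (S + - V)
    telescope F A V S = begin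
      (F + (A + - V)) + (S + - A)  ≡⟨ ℚP.+-assoc F _ _ ⟩
      F + ((A + - V) + (S + - A))  ≡⟨ cong (F +_) (ℚP.+-comm (A + - V) _) ⟩
      F + ((S + - A) + (A + - V))  ≡⟨ cong (F +_) (ℚP.+-assoc S (- A) _) ⟩
      F + (S + (- A + (A + - V)))  ≡⟨ cong (λ z → F + (S + z)) (sym (ℚP.+-assoc (- A) A (- V))) ⟩
      F + (S + ((- A + A) + - V))  ≡⟨ cong (λ z → F + (S + (z + - V))) (ℚP.+-inverseˡ A) ⟩
      F + (S + (0ℚ + - V))         ≡⟨ cong (λ z → F + (S + z)) (ℚP.+-identityˡ (- V)) ⟩
      F + (S + - V)                ∎
      where open ≡-Reasoning

    UnitAugmentation : Flow → Node n → Set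
    UnitAugmentation f v = Σ Flow (λ f′ → IntegralPseudoflow f′ ×
      (∀ w → netOut f′ w ≡ netOut f w + (bit (w == src) + - bit (w == v))))

    -- Every node of level i can receive one unit from s: push into v from
    -- its predecessor a on level i, then recursively send a unit from s to a.
    augment : ∀ i v f → IntegralPseudoflow f → reach i f v ≡ true → UnitAugmentation f v
    augment zero v f P v∈ with ==-sound {a = v} v∈
    ... | refl = f , P , λ w → sym (trans (cong (netOut f w +_) (ℚP.+-inverseʳ (bit (w == src)))) (ℚP.+-identityʳ _))
    augment (suc i) v f P v∈ with reach i f v in v∈i
    ... | true  = augment i v f P v∈i
    ... | false with any-witness (λ a → reach i f a ∧ residual f a v) (allNodes n) v∈
    ...   | a , e with ∧-elim {reach i f a} e
    ...     | a∈i , res with augment i a (push f a v) (push-pseudoflow f a v P (residual-sound f a v res))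
                                 (reach-preserved i f (push f a v) v (push-avoiding f a v) v∈i a a∈i)
    ...       | f′ , P′ , net = f′ , P′ , λ w →
      trans (net w)
        (trans (cong (_+ (bit (w == src) + - bit (w == a))) (netOut-push f a v w))
          (telescope (netOut f w) (bit (w == a)) (bit (w == v)) (bit (w == src))))

    -- Minimum cut and the Ford–Fulkerson iteration.

    -- If level i is stable and misses t, then f saturates every pair leaving
    -- it, so the value of f equals the capacity of this cut ({s} ∪ S, S the
    -- vertices on level i).
    stable⇒value≡sideCapacity : ∀ f → IntegralPseudoflow f → (∀ u → netOut f (vtx u) ≡ 0ℚ) →
      ∀ i → Levels.Stable f i → reach i f snk ≡ false →
      flowValue f ≡ ℕ→ℚ (sideCapacity (λ u → reach i f (vtx u)))
    stable⇒value≡sideCapacity f P conserve i stable t∉ =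
      trans (sym (outflow≡value f conserve R (reach-src i f) t∉))
        (trans (∑-out-of≡∑-across (allNodes n) R f (skew P))
          (trans (∑-cong (allNodes n) row)
            (trans (cutCapacity-cong onLevel) (cutCapacity-sourceSide (λ u → R (vtx u))))))
      where
      R : Node n → Bool
      R = reach i f
      onLevel : ∀ a → R a ≡ sourceSide (λ u → R (vtx u)) a
      onLevel src     = reach-src i f
      onLevel (vtx u) = refl
      onLevel snk     = t∉
      saturated : ∀ a b → R a ≡ true → R b ≡ false → f a b ≡ c a b
      saturated a b a∈ b∉ = ℚP.≤-antisym (capacity P a b) (ℚP.≮⇒≥ noResidual)
        where
        noResidual : ¬ (f a b < c a b)
        noResidual lt = true≢false (trans (sym (stable b b∈next)) b∉)
          where
          b∈next : reach (suc i) f b ≡ true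
          b∈next = ∨-introʳ (R b) (any-intro _ (∈-allNodes a)
                     (subst (λ r → (r ∧ residual f a b) ≡ true) (sym a∈) (residual-complete f a b lt)))
      row : ∀ a → (if R a then sumNodes (λ b → if R b then 0ℚ else f a b) else 0ℚ)
                ≡ (if R a then sumNodes (λ b → if R b then 0ℚ else c a b) else 0ℚ)
      row a with R a in a∈
      ... | false = refl
      ... | true  = ∑-cong (allNodes n) entry
        where
        entry : ∀ b → (if R b then 0ℚ else f a b) ≡ (if R b then 0ℚ else c a b)
        entry b with R b in b∉
        ... | true  = refl
        ... | false = saturated a b a∈ b∉

    GoodPartition : Set
    GoodPartition = Σ (Fin n → Bool) (λ S → IsVertexPartition S × S x ≡ true × cutSize G S ℕ.≤ k)

    -- A side {s} ∪ S of capacity at most 2νk + ν < C must contain x (else the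
    -- edge (s,x) is cut), must miss a vertex (vol(V) ≥ 2|E| ≥ C), and cuts at
    -- most k edges of G.
    smallSide⇒goodPartition : 0 ℕ.< ν → C ℕ.≤ 2 ℕ.* edgeCount G →
      ∀ S → sideCapacity S ℕ.≤ Y → GoodPartition
    smallSide⇒goodPartition ν>0 C≤2m S small with S x in x∈S
    ... | false = ⊥-elim (ℕP.m+1+n≰m Y (ℕP.≤-trans (ℕP.m≤m+n C _) small))
    ... | true  = S , ((x , x∈S) , outside) , x∈S , 2νe≤2νk+ν⇒e≤k k (cutSize G S) ν>0 cut≤
      where
      cut≤ : 2 ℕ.* ν ℕ.* cutSize G S ℕ.≤ Y
      cut≤ = ℕP.≤-trans (ℕP.m≤m+n _ (vol G S)) small
      vol≤ : vol G S ℕ.≤ Y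
      vol≤ = ℕP.≤-trans (ℕP.m≤n+m (vol G S) _) small
      outside : Σ (Fin n) (λ u → S u ≡ false)
      outside with FinP.any? (λ u → S u BoolP.≟ false)
      ... | yes u∉S = u∉S
      ... | no  none = ⊥-elim (ℕP.m+1+n≰m Y (ℕP.≤-trans C≤2m (ℕP.≤-trans (2edges≤vol G) (subst (ℕ._≤ Y) volS≡volV vol≤))))
        where
        volS≡volV : vol G S ≡ vol G (λ _ → true)
        volS≡volV = sum-map-cong (allFin n) (λ u → cong (λ b → if b then deg G u else 0) (BoolP.¬-not (λ e → none (u , e))))

    FlowOfValue : ℕ → Set
    FlowOfValue j = Σ Flow (λ f → IntegralPseudoflow f × (∀ u → netOut f (vtx u) ≡ 0ℚ) × flowValue f ≡ ℕ→ℚ j)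

    zeroFlow : FlowOfValue 0
    zeroFlow = (λ _ _ → 0ℚ)
             , record { skew = λ _ _ → refl
                      ; capacity = λ a b → ℕ→ℚ-≤ {0} {cap G x ν k a b} ℕ.z≤n
                      ; integral = λ _ _ → ℤ.+ 0 , refl }
             , (λ _ → ∑-0 (allNodes n)) , ∑-0 (allNodes n)

    -- One Ford–Fulkerson round: at a stable level, either t is reachable and
    -- a unit augmentation raises the value, or the level is a cut of capacity
    -- j ≤ 2νk + ν, which yields a good partition.
    augmentOrCut : 0 ℕ.< ν → C ℕ.≤ 2 ℕ.* edgeCount G →
      ∀ j → j ℕ.≤ Y → FlowOfValue j → GoodPartition ⊎ FlowOfValue (suc j)
    augmentOrCut ν>0 C≤2m j j≤Y (f , P , conserve , value) with Levels.stabilises f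
    ... | i , stable with reach i f snk in t∈
    ... | false = inj₁ (smallSide⇒goodPartition ν>0 C≤2m S
                    (ℕP.≤-trans (ℕ→ℚ-≤⁻ (ℚP.≤-reflexive cut≡j)) j≤Y))
      where
      S : Fin n → Bool
      S u = reach i f (vtx u)
      cut≡j : ℕ→ℚ (sideCapacity S) ≡ ℕ→ℚ j
      cut≡j = trans (sym (stable⇒value≡sideCapacity f P conserve i stable t∈)) value
    ... | true with augment i snk f P t∈
    ...   | f′ , P′ , net = inj₂ (f′ , P′ , conserve′ , value′)
      where
      conserve′ : ∀ u → netOut f′ (vtx u) ≡ 0ℚ
      conserve′ u = trans (net (vtx u)) (trans (cong (_+ (0ℚ + - 0ℚ)) (conserve u)) (ℚP.+-identityʳ 0ℚ))
      value′ : flowValue f′ ≡ ℕ→ℚ (suc j)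
      value′ = trans (net src)
        (trans (cong (_+ (1ℚ + - 0ℚ)) value) (trans (sym (ℕ→ℚ-+ j 1)) (cong ℕ→ℚ (ℕP.+-comm j 1))))

    fordFulkerson : 0 ℕ.< ν → C ℕ.≤ 2 ℕ.* edgeCount G → ∀ j → j ℕ.≤ C → GoodPartition ⊎ FlowOfValue j
    fordFulkerson ν>0 C≤2m zero    _   = inj₂ zeroFlow
    fordFulkerson ν>0 C≤2m (suc j) j<C with fordFulkerson ν>0 C≤2m j (ℕP.<⇒≤ j<C)
    ... | inj₁ good = inj₁ good
    ... | inj₂ flow = augmentOrCut ν>0 C≤2m j (ℕ.s≤s⁻¹ (subst (suc j ℕ.≤_) (ℕP.+-comm Y 1) j<C)) flow

    -- Part (2): if the maximum flow value is at most 2νk + ν, the flow of value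
    -- C cannot exist, so Ford–Fulkerson stops at a good partition.
    unsaturated⇒goodPartition : 0 ℕ.< ν → C ℕ.≤ 2 ℕ.* edgeCount G →
      (F : ℚ) → IsMaxFlowValue G x ν k F → F ≤ ℕ→ℚ Y → GoodPartition
    unsaturated⇒goodPartition ν>0 C≤2m F (_ , maximal) F≤Y with fordFulkerson ν>0 C≤2m C ℕP.≤-refl
    ... | inj₁ good = good
    ... | inj₂ (f , P , conserve , value) =
      ⊥-elim (ℕP.m+1+n≰m Y (ℕ→ℚ-≤⁻ (ℚP.≤-trans (subst (_≤ F) value (maximal f isFlow)) F≤Y)))
      where
      isFlow : IsFlow G x ν k f
      isFlow = record { skew = skew P ; capacity = capacity P ; conservation = conserve }

open import Defs
open import Data.Nat using (ℕ; _+_; _*_; _≤_; _<_)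
open import Data.Fin using (Fin)
open import Data.Bool using (Bool; true)
open import Data.Rational as ℚ using (ℚ)
open import Data.Product using (Σ; _×_; _,_)
open import Relation.Binary.PropositionalEquality using (_≡_)
open import Relation.Nullary using (¬_)

theorem2p1 : (n : ℕ) (G : Graph n) (x : Fin n) (ν k : ℕ) →
    0 < ν → 0 < k →
    2 * ν * k + ν + 1 ≤ 2 * edgeCount G →
    (F : ℚ) → IsMaxFlowValue G x ν k F →
    (F ≡ ℕ→ℚ (2 * ν * k + ν + 1) →
      ¬ Σ (Fin n → Bool) (λ S → IsVertexPartition S × S x ≡ true × vol G S ≤ ν × cutSize G S ≤ k))
    × (F ℚ.≤ ℕ→ℚ (2 * ν * k + ν) →
      Σ (Fin n → Bool) (λ S → IsVertexPartition S × S x ≡ true × cutSize G S ≤ k))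
theorem2p1 n G x ν k ν>0 _ C≤2m F maxFlow =
  saturated⇒noSmallSet F maxFlow , unsaturated⇒goodPartition ν>0 C≤2m F maxFlow
  where open MaxFlowMinCut.Network G x ν k
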